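{- For every integer $k>1$, the complete graph $K_{4k+2}$ has a $5$-null $1$-factorisation.
   Context: For a graph $G$ and positive integer $k$, a zero-sum $k$-flow of $G$ is a map $f:E(G)\to\{\pm1,\dots,\pm(k-1)\}$ such that the sum of $f$ over the edges incident with any vertex is $0$. A $1$-factorisation is a partition of $E(G)$ into $1$-factors (perfect matchings). $G$ has a $k$-null $1$-factorisation if there is a zero-sum $k$-flow $f$ of $G$ and a $1$-factorisation of $G$ in which every $1$-factor has weight zero, the weight of an edge set being the sum of the $f$-values of its edges. -}

module Defs where

open import Data.Nat as ℕ using (ℕ; zero; suc; _∸_)
open import Data.Integer as ℤ using (ℤ; ∣_∣; 0ℤ)
open import Data.Fin using (Fin; zero; suc; _<_; _<?_; _≟_)
open import Data.Product using (Σ; ∃; _×_; _,_)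
open import Data.Bool using (if_then_else_; _∧_)
open import Relation.Nullary using (¬_; does)
open import Relation.Binary.PropositionalEquality using (_≡_; _≢_)

sumFin : {n : ℕ} → (Fin n → ℤ) → ℤ
sumFin {zero}  g = 0ℤ
sumFin {suc n} g = g zero ℤ.+ sumFin {n} (λ i → g (suc i))

-- The complete graph K_n has vertex set Fin n and an edge {u,v} for every u ≢ v.
-- An edge labelling of K_n is given by a function on ordered pairs that is
-- symmetric on distinct pairs (diagonal values are irrelevant).
Symmetric : {n : ℕ} {A : Set} → (Fin n → Fin n → A) → Set
Symmetric {n} g = ∀ (u v : Fin n) → u ≢ v → g u v ≡ g v u

IsZeroSumFlow : (k n : ℕ) → (Fin n → Fin n → ℤ) → Set
IsZeroSumFlow k n f =
  Symmetric f ×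
  (∀ (u v : Fin n) → u ≢ v → (f u v ≢ 0ℤ) × (∣ f u v ∣ ℕ.≤ k ∸ 1)) ×
  (∀ (u : Fin n) → sumFin (λ v → if does (u ≟ v) then 0ℤ else f u v) ≡ 0ℤ)

-- A 1-factorisation of K_n with m factors: an assignment c of each edge to a
-- factor index in Fin m such that every class is a perfect matching, i.e.
-- every vertex u is incident with exactly one edge of each class i.
Is1Factorisation : (n m : ℕ) → (Fin n → Fin n → Fin m) → Set
Is1Factorisation n m c =
  Symmetric c ×
  (∀ (i : Fin m) (u : Fin n) →
     ∃ λ (v : Fin n) → (u ≢ v) × (c u v ≡ i) ×
       (∀ (w : Fin n) → u ≢ w → c u w ≡ i → w ≡ v))

factorWeight : {n m : ℕ} → (Fin n → Fin n → Fin m) → (Fin n → Fin n → ℤ) → Fin m → ℤ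
factorWeight c f i =
  sumFin (λ u → sumFin (λ v →
    if does (u <? v) ∧ does (c u v ≟ i) then f u v else 0ℤ))

HasNull1Factorisation : (k n : ℕ) → Set
HasNull1Factorisation k n =
  Σ (Fin n → Fin n → ℤ) λ f → IsZeroSumFlow k n f ×
  Σ ℕ λ m → Σ (Fin n → Fin n → Fin m) λ c → Is1Factorisation n m c ×
    (∀ (i : Fin m) → factorWeight c f i ≡ 0ℤ)

module Submission where

-- Write 4k + 2 = 2m with m = 2k + 1 and take two copies of ℤ/m as vertex set.  For
-- each s the edges {a, s − a} inside both copies, together with the edge joining the
-- two copies of the unique a with 2a = s (m is odd), form a 1-factor; for each d ≠ 0
-- the edges from a in the first copy to a + d in the second form another.  An edge
-- {a, b} inside a copy gets F (b − a), where F x = G x + G (−x) is even and Σ F = 0;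
-- the cross edge at a of difference d gets F 0 if d = 0, −σ_j h(a) if d = j + 1 and
-- σ_j h(a + k) if d = k + j + 1, where Σ σ = Σ h = 0.  At a vertex the edges inside
-- its copy contribute Σ F − F 0, the cross edge of difference 0 contributes F 0, and
-- the other cross edges Σ_j σ_j (h(a + k) − h(a)) = 0, resp. Σ_j σ_j (h(b − j − 1) −
-- h(b − j − 1)) = 0.  A sum factor has twice the weight Σ_a F (s − 2a) = Σ F = 0
-- since doubling permutes ℤ/m, and a difference factor has weight ±σ_j Σ h = 0.
-- Building G, σ and h from alternating signs keeps every value in {±1, …, ±4}.

open import Data.Nat.Base using (ℕ)
open import Defs

module FinSum where

  open import Data.Nat.Base as ℕ using (zero; suc)
  open import Data.Integer.Base using (ℤ; 0ℤ; -_; _+_; _*_)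
  import Data.Integer.Properties as ℤ
  open import Data.Fin using (Fin; zero; suc; _↑ˡ_; _↑ʳ_; splitAt; _≟_)
  import Data.Fin.Properties as Fin
  open import Data.Sum.Base using (_⊎_; inj₁; inj₂)
  open import Data.Fin.Permutation using (Permutation′; _⟨$⟩ʳ_)
  open import Data.Bool.Base using (if_then_else_)
  open import Function.Base using (_∘_)
  open import Relation.Nullary.Decidable.Core using (does)
  open import Relation.Binary.PropositionalEquality
  import Algebra.Properties.CommutativeMonoid.Sum ℤ.+-0-commutativeMonoid as Σ

  sumFin-cong : ∀ {n} {g h : Fin n → ℤ} → (∀ i → g i ≡ h i) → sumFin g ≡ sumFin h
  sumFin-cong {zero}  g≗h = refl
  sumFin-cong {suc n} g≗h = cong₂ _+_ (g≗h zero) (sumFin-cong (g≗h ∘ suc))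

  sumFin≡sum : ∀ {n} (g : Fin n → ℤ) → sumFin g ≡ Σ.sum g
  sumFin≡sum {zero}  g = refl
  sumFin≡sum {suc n} g = cong (g zero +_) (sumFin≡sum (g ∘ suc))

  sumFin-zero : ∀ n → sumFin {n} (λ _ → 0ℤ) ≡ 0ℤ
  sumFin-zero zero    = refl
  sumFin-zero (suc n) = trans (ℤ.+-identityˡ _) (sumFin-zero n)

  sumFin-+ : ∀ {n} (g h : Fin n → ℤ) → sumFin (λ i → g i + h i) ≡ sumFin g + sumFin h
  sumFin-+ g h = begin
    sumFin (λ i → g i + h i)  ≡⟨ sumFin≡sum (λ i → g i + h i) ⟩
    Σ.sum (λ i → g i + h i)   ≡⟨ Σ.∑-distrib-+ g h ⟩
    Σ.sum g + Σ.sum h         ≡⟨ cong₂ _+_ (sumFin≡sum g) (sumFin≡sum h) ⟨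
    sumFin g + sumFin h       ∎
    where open ≡-Reasoning

  sumFin-swap : ∀ {m n} (g : Fin m → Fin n → ℤ) →
                sumFin (λ u → sumFin (g u)) ≡ sumFin (λ v → sumFin (λ u → g u v))
  sumFin-swap g = begin
    sumFin (λ u → sumFin (g u))          ≡⟨ sumFin-cong (λ u → sumFin≡sum (g u)) ⟩
    sumFin (λ u → Σ.sum (g u))           ≡⟨ sumFin≡sum (λ u → Σ.sum (g u)) ⟩
    Σ.sum (λ u → Σ.sum (g u))            ≡⟨ Σ.∑-comm g ⟩
    Σ.sum (λ v → Σ.sum (λ u → g u v))    ≡⟨ sumFin≡sum (λ v → Σ.sum (λ u → g u v)) ⟨
    sumFin (λ v → Σ.sum (λ u → g u v))   ≡⟨ sumFin-cong (λ v → sumFin≡sum (λ u → g u v)) ⟨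
    sumFin (λ v → sumFin (λ u → g u v))  ∎
    where open ≡-Reasoning

  sumFin-permute : ∀ {n} (π : Permutation′ n) (g : Fin n → ℤ) →
                   sumFin (g ∘ (π ⟨$⟩ʳ_)) ≡ sumFin g
  sumFin-permute π g = begin
    sumFin (g ∘ (π ⟨$⟩ʳ_))   ≡⟨ sumFin≡sum (g ∘ (π ⟨$⟩ʳ_)) ⟩
    Σ.sum (g ∘ (π ⟨$⟩ʳ_))    ≡⟨ Σ.sum-permute g π ⟨
    Σ.sum g                  ≡⟨ sumFin≡sum g ⟨
    sumFin g                 ∎
    where open ≡-Reasoning

  sumFin-*ˡ : ∀ {n} (c : ℤ) (g : Fin n → ℤ) → sumFin (λ i → c * g i) ≡ c * sumFin g
  sumFin-*ˡ {zero}  c g = sym (ℤ.*-zeroʳ c)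
  sumFin-*ˡ {suc n} c g = begin
    c * g zero + sumFin (λ i → c * g (suc i))  ≡⟨ cong (c * g zero +_) (sumFin-*ˡ c (g ∘ suc)) ⟩
    c * g zero + c * sumFin (g ∘ suc)          ≡⟨ ℤ.*-distribˡ-+ c (g zero) _ ⟨
    c * sumFin g                               ∎
    where open ≡-Reasoning

  sumFin-*ʳ : ∀ {n} (c : ℤ) (g : Fin n → ℤ) → sumFin (λ i → g i * c) ≡ sumFin g * c
  sumFin-*ʳ {zero}  c g = refl
  sumFin-*ʳ {suc n} c g = begin
    g zero * c + sumFin (λ i → g (suc i) * c)  ≡⟨ cong (g zero * c +_) (sumFin-*ʳ c (g ∘ suc)) ⟩
    g zero * c + sumFin (g ∘ suc) * c          ≡⟨ ℤ.*-distribʳ-+ c (g zero) _ ⟨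
    sumFin g * c                               ∎
    where open ≡-Reasoning

  sumFin-neg : ∀ {n} (g : Fin n → ℤ) → sumFin (λ i → - g i) ≡ - sumFin g
  sumFin-neg {zero}  g = refl
  sumFin-neg {suc n} g = trans (cong (- g zero +_) (sumFin-neg (g ∘ suc))) (sym (ℤ.neg-distrib-+ (g zero) _))

  sumFin-↑ : ∀ a b (g : Fin (a ℕ.+ b) → ℤ) →
             sumFin g ≡ sumFin (λ i → g (i ↑ˡ b)) + sumFin (λ j → g (a ↑ʳ j))
  sumFin-↑ zero    b g = sym (ℤ.+-identityˡ _)
  sumFin-↑ (suc a) b g = trans (cong (g zero +_) (sumFin-↑ a b (g ∘ suc))) (sym (ℤ.+-assoc (g zero) _ _))

  sumFin-splitAt : ∀ a b (g : Fin a ⊎ Fin b → ℤ) →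
                   sumFin (g ∘ splitAt a) ≡ sumFin (g ∘ inj₁) + sumFin (g ∘ inj₂)
  sumFin-splitAt a b g = trans (sumFin-↑ a b (g ∘ splitAt a)) (cong₂ _+_
    (sumFin-cong (λ i → cong g (Fin.splitAt-↑ˡ a i b)))
    (sumFin-cong (λ j → cong g (Fin.splitAt-↑ʳ a b j))))

  sumFin-except : ∀ {n} (u : Fin n) (g : Fin n → ℤ) →
                  sumFin (λ v → if does (u ≟ v) then 0ℤ else g v) + g u ≡ sumFin g
  sumFin-except zero    g = trans (ℤ.+-comm _ (g zero)) (cong (g zero +_) (ℤ.+-identityˡ _))
  sumFin-except (suc u) g = trans (ℤ.+-assoc (g zero) _ _) (cong (g zero +_) (sumFin-except u (g ∘ suc)))

  sumFin-single : ∀ {n} (u : Fin n) (g : Fin n → ℤ) →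
                  sumFin (λ v → if does (u ≟ v) then g v else 0ℤ) ≡ g u
  sumFin-single {suc n} zero g = trans (cong (g zero +_) (sumFin-zero n)) (ℤ.+-identityʳ _)
  sumFin-single {suc n} (suc u) g = trans (ℤ.+-identityˡ _) (sumFin-single u (g ∘ suc))

module Factorisation where

  open FinSum
  open import Data.Nat.Base as ℕ using (_∸_)
  open import Data.Integer.Base using (ℤ; 0ℤ; +0; +[1+_]; -[1+_]; _+_; ∣_∣)
  import Data.Integer.Properties as ℤ
  open import Data.Fin using (Fin; _≟_; _<?_)
  import Data.Fin.Properties as Fin
  open import Data.Bool.Base using (if_then_else_)
  open import Data.Bool.Properties using (if-∧)
  open import Data.Product.Base using (_,_)
  open import Function.Bundles using (_↔_; Inverse)
  open import Relation.Nullary.Decidable using (does; yes; no; dec-true; dec-false)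
  open import Data.Empty using (⊥-elim)
  open import Relation.Binary.Definitions using (tri<; tri≈; tri>)
  open import Relation.Binary.PropositionalEquality
  open import Algebra.Properties.AbelianGroup ℤ.+-0-abelianGroup using (identityˡ-unique)

  record Null1FactorisationOn (k : ℕ) (V C : Set) (∑ : (V → ℤ) → ℤ) : Set where
    field
      flow    : V → V → ℤ
      colour  : V → V → C
      partner : C → V → V
      flow-sym        : ∀ x y → flow x y ≡ flow y x
      colour-sym      : ∀ x y → colour x y ≡ colour y x
      flow-nonZero    : ∀ x y → x ≢ y → flow x y ≢ 0ℤ
      flow-bounded    : ∀ x y → x ≢ y → ∣ flow x y ∣ ℕ.≤ k ∸ 1
      partner-≢       : ∀ i x → x ≢ partner i x
      colour-partner  : ∀ i x → colour x (partner i x) ≡ i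
      partner-unique  : ∀ i x y → x ≢ y → colour x y ≡ i → y ≡ partner i x
      -- flow x x is never an edge value; requiring it to be the full row sum is
      -- the zero-sum condition at x without having to delete the diagonal term.
      ∑-flow          : ∀ x → ∑ (flow x) ≡ flow x x
      ∑-flow-partner  : ∀ i → ∑ (λ x → flow x (partner i x)) ≡ 0ℤ

  relabel : ∀ {k n c V C ∑} (vertices : Fin n ↔ V) (colours : Fin c ↔ C) →
            (∀ g → sumFin (λ u → g (Inverse.to vertices u)) ≡ ∑ g) →
            Null1FactorisationOn k V C ∑ → Null1FactorisationOn k (Fin n) (Fin c) sumFin
  relabel vertices colours sumFin≡∑ N = record
    { flow    = λ u v → flow (to u) (to v)
    ; colour  = λ u v → fromᶜ (colour (to u) (to v))
    ; partner = λ i u → from (partner (toᶜ i) (to u))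
    ; flow-sym   = λ u v → flow-sym (to u) (to v)
    ; colour-sym = λ u v → cong fromᶜ (colour-sym (to u) (to v))
    ; flow-nonZero = λ u v u≢v → flow-nonZero (to u) (to v) (to-≢ u≢v)
    ; flow-bounded = λ u v u≢v → flow-bounded (to u) (to v) (to-≢ u≢v)
    ; partner-≢      = λ i u u≡p → partner-≢ (toᶜ i) (to u) (trans (cong to u≡p) (to-from _))
    ; colour-partner = λ i u → trans (cong (λ y → fromᶜ (colour (to u) y)) (to-from _))
                                     (trans (cong fromᶜ (colour-partner (toᶜ i) (to u))) (fromᶜ-toᶜ i))
    ; partner-unique = λ i u w u≢w col →
        trans (sym (from-to w)) (cong from (partner-unique (toᶜ i) (to u) (to w) (to-≢ u≢w)
          (trans (sym (toᶜ-fromᶜ _)) (cong toᶜ col))))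
    ; ∑-flow         = λ u → trans (sumFin≡∑ (flow (to u))) (∑-flow (to u))
    ; ∑-flow-partner = λ i → trans (sumFin-cong (λ u → cong (flow (to u)) (to-from _)))
                                   (trans (sumFin≡∑ _) (∑-flow-partner (toᶜ i)))
    }
    where
    open Null1FactorisationOn N
    open Inverse vertices using (to; from) renaming (strictlyInverseˡ to to-from; strictlyInverseʳ to from-to)
    open Inverse colours using () renaming (to to toᶜ; from to fromᶜ;
                                            strictlyInverseˡ to toᶜ-fromᶜ; strictlyInverseʳ to fromᶜ-toᶜ)
    to-≢ : ∀ {u w} → u ≢ w → to u ≢ to w
    to-≢ {u} {w} u≢w tu≡tw = u≢w (trans (sym (from-to u)) (trans (cong from tu≡tw) (from-to w)))

  i+i≡0⇒i≡0 : ∀ i → i + i ≡ 0ℤ → i ≡ 0ℤ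
  i+i≡0⇒i≡0 +0       _  = refl
  i+i≡0⇒i≡0 +[1+ _ ] ()
  i+i≡0⇒i≡0 -[1+ _ ] ()

  upperSum : ∀ {n} → (Fin n → Fin n → ℤ) → ℤ
  upperSum E = sumFin (λ u → sumFin (λ v → if does (u <? v) then E u v else 0ℤ))

  offDiagonal-split : ∀ {n} (u v : Fin n) (e : ℤ) →
    (if does (u ≟ v) then 0ℤ else e) ≡
    (if does (u <? v) then e else 0ℤ) + (if does (v <? u) then e else 0ℤ)
  offDiagonal-split u v e with Fin.<-cmp u v
  ... | tri< u<v _ v≮u rewrite dec-false (u ≟ v) (Fin.<⇒≢ u<v) | dec-true (u <? v) u<v
                            | dec-false (v <? u) v≮u = sym (ℤ.+-identityʳ e)
  ... | tri≈ _ refl _  rewrite dec-true (u ≟ u) refl | dec-false (u <? u) (Fin.<-irrefl refl) = refl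
  ... | tri> u≮v _ v<u rewrite dec-false (u ≟ v) (λ u≡v → Fin.<⇒≢ v<u (sym u≡v)) | dec-false (u <? v) u≮v
                            | dec-true (v <? u) v<u = sym (ℤ.+-identityˡ e)

  upperSum-double : ∀ {n} (E : Fin n → Fin n → ℤ) → (∀ u v → E u v ≡ E v u) →
    upperSum E + upperSum E ≡
    sumFin (λ u → sumFin (λ v → if does (u ≟ v) then 0ℤ else E u v))
  upperSum-double {n} E E-sym = sym (begin
    sumFin (λ u → sumFin (λ v → if does (u ≟ v) then 0ℤ else E u v))
      ≡⟨ sumFin-cong (λ u → sumFin-cong (λ v → offDiagonal-split u v (E u v))) ⟩
    sumFin (λ u → sumFin (λ v → upper u v + lower u v))
      ≡⟨ sumFin-cong (λ u → sumFin-+ (upper u) (lower u)) ⟩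
    sumFin (λ u → sumFin (upper u) + sumFin (lower u))
      ≡⟨ sumFin-+ (λ u → sumFin (upper u)) (λ u → sumFin (lower u)) ⟩
    upperSum E + sumFin (λ u → sumFin (lower u))
      ≡⟨ cong (upperSum E +_) (sumFin-swap lower) ⟩
    upperSum E + sumFin (λ v → sumFin (λ u → lower u v))
      ≡⟨ cong (upperSum E +_) (sumFin-cong (λ v → sumFin-cong (λ u →
           cong (λ e → if does (v <? u) then e else 0ℤ) (E-sym u v)))) ⟩
    upperSum E + upperSum E ∎)
    where
    open ≡-Reasoning
    upper lower : Fin n → Fin n → ℤ
    upper u v = if does (u <? v) then E u v else 0ℤ
    lower u v = if does (v <? u) then E u v else 0ℤ

  module _ {k n c} (N : Null1FactorisationOn k (Fin n) (Fin c) sumFin) where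

    open Null1FactorisationOn N

    colourClass : Fin c → Fin n → Fin n → ℤ
    colourClass i u v = if does (colour u v ≟ i) then flow u v else 0ℤ

    factorWeight≡upperSum : ∀ i → factorWeight colour flow i ≡ upperSum (colourClass i)
    factorWeight≡upperSum i =
      sumFin-cong (λ u → sumFin-cong (λ v → if-∧ (does (u <? v)) {does (colour u v ≟ i)}))

    colourClass-row : ∀ i u →
      sumFin (λ v → if does (u ≟ v) then 0ℤ else colourClass i u v) ≡ flow u (partner i u)
    colourClass-row i u = trans (sumFin-cong entry) (sumFin-single (partner i u) (flow u))
      where
      entry : ∀ v → (if does (u ≟ v) then 0ℤ else colourClass i u v) ≡
                    (if does (partner i u ≟ v) then flow u v else 0ℤ)
      entry v with u ≟ v | partner i u ≟ v | colour u v ≟ i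
      ... | yes refl | yes u≡p  | _        = ⊥-elim (partner-≢ i u (sym u≡p))
      ... | yes refl | no _     | _        = refl
      ... | no _     | yes refl | yes _    = refl
      ... | no _     | yes refl | no c≢i   = ⊥-elim (c≢i (colour-partner i u))
      ... | no u≢v   | no p≢v   | yes c≡i  = ⊥-elim (p≢v (sym (partner-unique i u v u≢v c≡i)))
      ... | no _     | no _     | no _     = refl

    factorWeight-double : ∀ i →
      factorWeight colour flow i + factorWeight colour flow i ≡ sumFin (λ u → flow u (partner i u))
    factorWeight-double i = begin
      factorWeight colour flow i + factorWeight colour flow i
        ≡⟨ cong₂ _+_ (factorWeight≡upperSum i) (factorWeight≡upperSum i) ⟩
      upperSum (colourClass i) + upperSum (colourClass i)
        ≡⟨ upperSum-double (colourClass i) colourClass-sym ⟩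
      sumFin (λ u → sumFin (λ v → if does (u ≟ v) then 0ℤ else colourClass i u v))
        ≡⟨ sumFin-cong (colourClass-row i) ⟩
      sumFin (λ u → flow u (partner i u)) ∎
      where
      open ≡-Reasoning
      colourClass-sym : ∀ u v → colourClass i u v ≡ colourClass i v u
      colourClass-sym u v rewrite colour-sym u v | flow-sym u v = refl

    vertexSum-zero : ∀ u → sumFin (λ v → if does (u ≟ v) then 0ℤ else flow u v) ≡ 0ℤ
    vertexSum-zero u = identityˡ-unique _ (flow u u) (trans (sumFin-except u (flow u)) (∑-flow u))

    hasNull1Factorisation : HasNull1Factorisation k n
    hasNull1Factorisation = flow , isZeroSumFlow , c , colour , is1Factorisation , factorWeight-zero
      where
      isZeroSumFlow : IsZeroSumFlow k n flow
      isZeroSumFlow = (λ u v _ → flow-sym u v)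
                    , (λ u v u≢v → flow-nonZero u v u≢v , flow-bounded u v u≢v)
                    , vertexSum-zero
      is1Factorisation : Is1Factorisation n c colour
      is1Factorisation = (λ u v _ → colour-sym u v)
                       , (λ i u → partner i u , partner-≢ i u , colour-partner i u , partner-unique i u)
      factorWeight-zero : ∀ i → factorWeight colour flow i ≡ 0ℤ
      factorWeight-zero i = i+i≡0⇒i≡0 _ (trans (factorWeight-double i) (∑-flow-partner i))

module Cyclic (n : ℕ) where

  open FinSum
  open import Data.Nat.Base using (suc; _+_; _*_; _∸_; _<_)
  open import Data.Nat.Properties using (+-assoc; +-comm; +-identityʳ; *-distribʳ-+; m+[n∸m]≡n; <⇒≤; ∸-monoʳ-<)
  open import Data.Nat.DivMod
    using (_mod_; _%_; m%n<n; m<n⇒m%n≡m; m%n%n≡m%n; [m+n]%n≡m%n; [m+kn]%n≡m%n; %-distribˡ-+; %-distribˡ-*)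
  open import Data.Nat.Tactic.RingSolver using (solve-∀)
  open import Data.Integer.Base using (ℤ)
  open import Data.Fin.Base using (Fin; zero; toℕ)
  open import Data.Fin.Properties using (toℕ-fromℕ<; toℕ-injective; toℕ<n)
  open import Data.Fin.Permutation using (Permutation′; permutation)
  open import Data.Product.Base using (_,_)
  open import Algebra.Bundles using (AbelianGroup)
  open import Algebra.Structures using (IsAbelianGroup)
  open import Relation.Binary.PropositionalEquality
    using (_≡_; refl; sym; trans; cong; cong₂; isEquivalence; module ≡-Reasoning)

  private
    m : ℕ
    m = suc n

  infixl 6 _⊕_ _⊖_
  infix  8 ⊝_

  -- Opaque, since unfolding the modular arithmetic during type checking is prohibitively expensive.
  opaque

    [_] : ℕ → Fin m
    [ x ] = x mod m

    _⊕_ : Fin m → Fin m → Fin m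
    a ⊕ b = [ toℕ a + toℕ b ]

    ⊝_ : Fin m → Fin m
    ⊝ a = [ m ∸ toℕ a ]

    toℕ-[] : ∀ x → toℕ [ x ] ≡ x % m
    toℕ-[] x = toℕ-fromℕ< (m%n<n x m)

    ⊕-def : ∀ a b → a ⊕ b ≡ [ toℕ a + toℕ b ]
    ⊕-def a b = refl

    ⊝-def : ∀ a → ⊝ a ≡ [ m ∸ toℕ a ]
    ⊝-def a = refl

  _⊖_ : Fin m → Fin m → Fin m
  a ⊖ b = a ⊕ ⊝ b

  []-cong-% : ∀ {x y} → x % m ≡ y % m → [ x ] ≡ [ y ]
  []-cong-% {x} {y} eq = toℕ-injective (trans (toℕ-[] x) (trans eq (sym (toℕ-[] y))))

  [toℕ] : ∀ a → [ toℕ a ] ≡ a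
  [toℕ] a = toℕ-injective (trans (toℕ-[] (toℕ a)) (m<n⇒m%n≡m (toℕ<n a)))

  [0]≡zero : [ 0 ] ≡ zero
  [0]≡zero = toℕ-injective (toℕ-[] 0)

  []-+ : ∀ x y → [ x + y ] ≡ [ x ] ⊕ [ y ]
  []-+ x y = trans ([]-cong-% (begin
    (x + y) % m                        ≡⟨ %-distribˡ-+ x y m ⟩
    (x % m + y % m) % m                ≡⟨ cong₂ (λ a b → (a + b) % m) (toℕ-[] x) (toℕ-[] y) ⟨
    (toℕ [ x ] + toℕ [ y ]) % m        ∎)) (sym (⊕-def [ x ] [ y ]))
    where open ≡-Reasoning

  ⊕-assoc : ∀ a b c → (a ⊕ b) ⊕ c ≡ a ⊕ (b ⊕ c)
  ⊕-assoc a b c = begin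
    (a ⊕ b) ⊕ c              ≡⟨ cong₂ _⊕_ (⊕-def a b) (sym ([toℕ] c)) ⟩
    [ A + B ] ⊕ [ C ]        ≡⟨ []-+ (A + B) C ⟨
    [ A + B + C ]            ≡⟨ cong [_] (+-assoc A B C) ⟩
    [ A + (B + C) ]          ≡⟨ []-+ A (B + C) ⟩
    [ A ] ⊕ [ B + C ]        ≡⟨ cong₂ _⊕_ ([toℕ] a) (sym (⊕-def b c)) ⟩
    a ⊕ (b ⊕ c)              ∎
    where
    open ≡-Reasoning
    A = toℕ a
    B = toℕ b
    C = toℕ c

  ⊕-comm : ∀ a b → a ⊕ b ≡ b ⊕ a
  ⊕-comm a b = trans (⊕-def a b) (trans (cong [_] (+-comm (toℕ a) (toℕ b))) (sym (⊕-def b a)))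

  ⊕-identityʳ : ∀ a → a ⊕ zero ≡ a
  ⊕-identityʳ a = begin
    a ⊕ zero           ≡⟨ cong₂ _⊕_ ([toℕ] a) [0]≡zero ⟨
    [ toℕ a ] ⊕ [ 0 ]  ≡⟨ []-+ (toℕ a) 0 ⟨
    [ toℕ a + 0 ]      ≡⟨ cong [_] (+-identityʳ (toℕ a)) ⟩
    [ toℕ a ]          ≡⟨ [toℕ] a ⟩
    a                  ∎
    where open ≡-Reasoning

  ⊕-inverseʳ : ∀ a → a ⊖ a ≡ zero
  ⊕-inverseʳ a = begin
    a ⊕ ⊝ a                        ≡⟨ cong₂ _⊕_ (sym ([toℕ] a)) (⊝-def a) ⟩
    [ toℕ a ] ⊕ [ m ∸ toℕ a ]      ≡⟨ []-+ (toℕ a) (m ∸ toℕ a) ⟨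
    [ toℕ a + (m ∸ toℕ a) ]        ≡⟨ cong [_] (m+[n∸m]≡n (<⇒≤ (toℕ<n a))) ⟩
    [ m ]                          ≡⟨ []-cong-% ([m+n]%n≡m%n 0 m) ⟩
    [ 0 ]                          ≡⟨ [0]≡zero ⟩
    zero                           ∎
    where open ≡-Reasoning

  ⊕-isAbelianGroup : IsAbelianGroup _≡_ _⊕_ zero ⊝_
  ⊕-isAbelianGroup = record
    { isGroup = record
      { isMonoid = record
        { isSemigroup = record
          { isMagma = record { isEquivalence = isEquivalence ; ∙-cong = cong₂ _⊕_ }
          ; assoc = ⊕-assoc }
        ; identity = (λ a → trans (⊕-comm zero a) (⊕-identityʳ a)) , ⊕-identityʳ }
      ; inverse = (λ a → trans (⊕-comm (⊝ a) a) (⊕-inverseʳ a)) , ⊕-inverseʳ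
      ; ⁻¹-cong = cong ⊝_ }
    ; comm = ⊕-comm }

  ⊕-abelianGroup : AbelianGroup _ _
  ⊕-abelianGroup = record { isAbelianGroup = ⊕-isAbelianGroup }

  open import Algebra.Properties.AbelianGroup ⊕-abelianGroup
    using (//-rightDividesˡ; //-rightDividesʳ; x∙y⁻¹≈ε⇒x≈y; ε⁻¹≈ε; ⁻¹-involutive; ⁻¹-anti-homo-//; ⁻¹-∙-comm)

  ⊝-involutive : ∀ a → ⊝ ⊝ a ≡ a
  ⊝-involutive = ⁻¹-involutive

  ⊝-zero : ⊝ zero ≡ zero
  ⊝-zero = ε⁻¹≈ε

  ⊖-⊕-cancel : ∀ a b → (a ⊖ b) ⊕ b ≡ a
  ⊖-⊕-cancel a b = //-rightDividesˡ b a

  ⊕-⊖-cancel : ∀ a b → (a ⊕ b) ⊖ b ≡ a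
  ⊕-⊖-cancel a b = //-rightDividesʳ b a

  ⊕-⊖-cancelˡ : ∀ a b → (a ⊕ b) ⊖ a ≡ b
  ⊕-⊖-cancelˡ a b = trans (cong (_⊖ a) (⊕-comm a b)) (⊕-⊖-cancel b a)

  a⊕[b⊖a]≡b : ∀ a b → a ⊕ (b ⊖ a) ≡ b
  a⊕[b⊖a]≡b a b = trans (⊕-comm a (b ⊖ a)) (⊖-⊕-cancel b a)

  ⊖-⊖-cancel : ∀ a b → a ⊖ (a ⊖ b) ≡ b
  ⊖-⊖-cancel a b = trans (cong (a ⊕_) (⁻¹-anti-homo-// a b)) (a⊕[b⊖a]≡b a b)

  ⊖≡0⇒≡ : ∀ {a b} → a ⊖ b ≡ zero → a ≡ b
  ⊖≡0⇒≡ {a} {b} = x∙y⁻¹≈ε⇒x≈y a b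

  ⊕≡⇒≡⊖ : ∀ {a b s} → a ⊕ b ≡ s → b ≡ s ⊖ a
  ⊕≡⇒≡⊖ {a} {b} refl = sym (⊕-⊖-cancelˡ a b)

  ⊖≡⇒≡⊕ : ∀ {a b d} → b ⊖ a ≡ d → b ≡ a ⊕ d
  ⊖≡⇒≡⊕ {a} {b} refl = sym (a⊕[b⊖a]≡b a b)

  ⊖≡⇒≡⊖ : ∀ {a b d} → b ⊖ a ≡ d → a ≡ b ⊖ d
  ⊖≡⇒≡⊖ {a} {b} refl = sym (⊖-⊖-cancel b a)

  ⊖-anticomm : ∀ a b → a ⊖ b ≡ ⊝ (b ⊖ a)
  ⊖-anticomm a b = sym (⁻¹-anti-homo-// b a)

  ⊖-⊖ : ∀ a b c → (a ⊖ b) ⊖ c ≡ a ⊖ (b ⊕ c)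
  ⊖-⊖ a b c = trans (⊕-assoc a (⊝ b) (⊝ c)) (cong (a ⊕_) (⁻¹-∙-comm b c))

  ⊖-⊕-shift : ∀ a b c → (a ⊖ (b ⊕ c)) ⊕ c ≡ a ⊖ b
  ⊖-⊕-shift a b c = trans (cong (_⊕ c) (sym (⊖-⊖ a b c))) (⊖-⊕-cancel (a ⊖ b) c)

  translation : Fin m → Permutation′ m
  translation b = permutation (_⊕ b) (_⊖ b) (λ a → ⊖-⊕-cancel a b) (λ a → ⊕-⊖-cancel a b)

  reflection : Fin m → Permutation′ m
  reflection a = permutation (a ⊖_) (a ⊖_) (⊖-⊖-cancel a) (⊖-⊖-cancel a)

  sumFin-translate : ∀ b (g : Fin m → ℤ) → sumFin (λ a → g (a ⊕ b)) ≡ sumFin g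
  sumFin-translate b = sumFin-permute (translation b)

  sumFin-reflect : ∀ a (g : Fin m → ℤ) → sumFin (λ b → g (a ⊖ b)) ≡ sumFin g
  sumFin-reflect a = sumFin-permute (reflection a)

  sumFin-negate : ∀ (g : Fin m → ℤ) → sumFin (λ a → g (⊝ a)) ≡ sumFin g
  sumFin-negate = sumFin-permute (permutation ⊝_ ⊝_ ⊝-involutive ⊝-involutive)

  toℕ-⊝ : ∀ a → 0 < toℕ a → toℕ (⊝ a) ≡ m ∸ toℕ a
  toℕ-⊝ a 0<a = trans (cong toℕ (⊝-def a))
    (trans (toℕ-[] (m ∸ toℕ a)) (m<n⇒m%n≡m (∸-monoʳ-< 0<a (<⇒≤ (toℕ<n a)))))

  module _ {h : ℕ} (n≡2h : n ≡ h + h) where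

    -- h + 1 is the inverse of 2 modulo m = 2h + 1.
    halve : Fin m → Fin m
    halve a = [ toℕ a * suc h ]

    twice-%-cancel : ∀ x → (x * suc h + x * suc h) % m ≡ x % m
    twice-%-cancel x = begin
      (x * suc h + x * suc h) % m   ≡⟨ cong (_% m) (lemma x h) ⟩
      (x + x * suc (h + h)) % m     ≡⟨ cong (λ k → (x + x * suc k) % m) n≡2h ⟨
      (x + x * m) % m               ≡⟨ [m+kn]%n≡m%n x x m ⟩
      x % m                         ∎
      where
      open ≡-Reasoning
      lemma : ∀ x h → x * suc h + x * suc h ≡ x + x * suc (h + h)
      lemma = solve-∀

    halve-double : ∀ a → halve a ⊕ halve a ≡ a
    halve-double a = begin
      [ A * suc h ] ⊕ [ A * suc h ]    ≡⟨ []-+ (A * suc h) (A * suc h) ⟨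
      [ A * suc h + A * suc h ]        ≡⟨ []-cong-% (twice-%-cancel A) ⟩
      [ A ]                            ≡⟨ [toℕ] a ⟩
      a                                ∎
      where
      open ≡-Reasoning
      A = toℕ a

    double-halve : ∀ a → halve (a ⊕ a) ≡ a
    double-halve a = begin
      [ toℕ (a ⊕ a) * suc h ]          ≡⟨ []-cong-% (cong (λ n → (n * suc h) % m)
                                            (trans (cong toℕ (⊕-def a a)) (toℕ-[] (A + A)))) ⟩
      [ (A + A) % m * suc h ]          ≡⟨ []-cong-% ([m%d*n]%d≡[m*n]%d (A + A) (suc h)) ⟩
      [ (A + A) * suc h ]              ≡⟨ cong [_] (*-distribʳ-+ (suc h) A A) ⟩
      [ A * suc h + A * suc h ]        ≡⟨ []-cong-% (twice-%-cancel A) ⟩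
      [ A ]                            ≡⟨ [toℕ] a ⟩
      a                                ∎
      where
      open ≡-Reasoning
      A = toℕ a
      [m%d*n]%d≡[m*n]%d : ∀ x c → (x % m * c) % m ≡ (x * c) % m
      [m%d*n]%d≡[m*n]%d x c = begin
        (x % m * c) % m              ≡⟨ %-distribˡ-* (x % m) c m ⟩
        (x % m % m * (c % m)) % m    ≡⟨ cong (λ y → (y * (c % m)) % m) (m%n%n≡m%n x m) ⟩
        (x % m * (c % m)) % m        ≡⟨ %-distribˡ-* x c m ⟨
        (x * c) % m                  ∎

    sumFin-double : ∀ (g : Fin m → ℤ) → sumFin (λ a → g (a ⊕ a)) ≡ sumFin g
    sumFin-double = sumFin-permute (permutation (λ a → a ⊕ a) halve halve-double double-halve)

module SmallValues where

  open FinSum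

  open import Data.Nat.Base as ℕ using (zero; suc; z≤n; s≤s; _≤ᵇ_)
  import Data.Nat.Properties as ℕ
  open import Data.Integer.Base using (ℤ; 0ℤ; 1ℤ; -1ℤ; +_; -_; _+_; _*_; ∣_∣)
  import Data.Integer.Properties as ℤ
  open import Data.Fin.Base using (Fin; zero; suc)
  open import Data.Bool.Base using (T)
  open import Data.Sum.Base using (_⊎_; inj₁; inj₂)
  open import Relation.Binary.PropositionalEquality

  record NonZeroWithin (b : ℕ) (x : ℤ) : Set where
    constructor _,_
    field
      1≤∣x∣ : 1 ℕ.≤ ∣ x ∣
      ∣x∣≤b : ∣ x ∣ ℕ.≤ b

  nonZeroWithin : ∀ b x → {T (1 ≤ᵇ ∣ x ∣)} → {T (∣ x ∣ ≤ᵇ b)} → NonZeroWithin b x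
  nonZeroWithin b x {1≤x} {x≤b} = ℕ.≤ᵇ⇒≤ 1 (∣ x ∣) 1≤x , ℕ.≤ᵇ⇒≤ (∣ x ∣) b x≤b

  nonZeroWithin⇒≢0 : ∀ {b x} → NonZeroWithin b x → x ≢ 0ℤ
  nonZeroWithin⇒≢0 (1≤∣x∣ , _) refl with () ← 1≤∣x∣

  nonZeroWithin-weaken : ∀ {b c x} → b ℕ.≤ c → NonZeroWithin b x → NonZeroWithin c x
  nonZeroWithin-weaken b≤c (1≤∣x∣ , ∣x∣≤b) = 1≤∣x∣ , ℕ.≤-trans ∣x∣≤b b≤c

  nonZeroWithin-neg : ∀ {b x} → NonZeroWithin b x → NonZeroWithin b (- x)
  nonZeroWithin-neg {b} {x} (1≤∣x∣ , ∣x∣≤b) =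
    subst (1 ℕ.≤_) ∣x∣≡∣-x∣ 1≤∣x∣ , subst (ℕ._≤ b) ∣x∣≡∣-x∣ ∣x∣≤b
    where ∣x∣≡∣-x∣ = sym (ℤ.∣-i∣≡∣i∣ x)

  nonZeroWithin-* : ∀ {b c x y} → NonZeroWithin b x → NonZeroWithin c y → NonZeroWithin (b ℕ.* c) (x * y)
  nonZeroWithin-* {b} {c} {x} {y} (1≤∣x∣ , ∣x∣≤b) (1≤∣y∣ , ∣y∣≤c) =
    subst (1 ℕ.≤_) ∣xy∣ (ℕ.*-mono-≤ 1≤∣x∣ 1≤∣y∣) , subst (ℕ._≤ b ℕ.* c) ∣xy∣ (ℕ.*-mono-≤ ∣x∣≤b ∣y∣≤c)
    where ∣xy∣ = sym (ℤ.abs-* x y)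

  IsSign : ℤ → Set
  IsSign x = x ≡ 1ℤ ⊎ x ≡ -1ℤ

  sign-nonZeroWithin : ∀ {x} → IsSign x → NonZeroWithin 1 x
  sign-nonZeroWithin (inj₁ refl) = nonZeroWithin 1 1ℤ
  sign-nonZeroWithin (inj₂ refl) = nonZeroWithin 1 -1ℤ

  twice-minus-nonZeroWithin : ∀ {x y} → IsSign x → IsSign y → NonZeroWithin 3 (+ 2 * x + - y)
  twice-minus-nonZeroWithin (inj₁ refl) (inj₁ refl) = nonZeroWithin 3 1ℤ
  twice-minus-nonZeroWithin (inj₁ refl) (inj₂ refl) = nonZeroWithin 3 (+ 3)
  twice-minus-nonZeroWithin (inj₂ refl) (inj₁ refl) = nonZeroWithin 3 (- + 3)
  twice-minus-nonZeroWithin (inj₂ refl) (inj₂ refl) = nonZeroWithin 3 -1ℤ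

  alternating : ∀ {n} → Fin n → ℤ
  alternating zero          = 1ℤ
  alternating (suc zero)    = -1ℤ
  alternating (suc (suc j)) = alternating j

  alternating-sign : ∀ {n} (j : Fin n) → IsSign (alternating j)
  alternating-sign zero          = inj₁ refl
  alternating-sign (suc zero)    = inj₂ refl
  alternating-sign (suc (suc j)) = alternating-sign j

  sumFin-alternating : ∀ n → sumFin {n} alternating ≡ 0ℤ ⊎ sumFin {n} alternating ≡ 1ℤ
  sumFin-alternating zero          = inj₁ refl
  sumFin-alternating (suc zero)    = inj₂ refl
  sumFin-alternating (suc (suc n)) with sumFin {n} alternating | sumFin-alternating n
  ... | _ | inj₁ refl = inj₁ refl
  ... | _ | inj₂ refl = inj₂ refl

  signs : ∀ {n} → Fin n → ℤ
  signs zero    = 1ℤ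
  signs (suc j) = alternating j

  signs-sign : ∀ {n} (j : Fin n) → IsSign (signs j)
  signs-sign zero    = inj₁ refl
  signs-sign (suc j) = alternating-sign j

  sumFin-signs : ∀ n → sumFin {suc n} signs ≡ 1ℤ ⊎ sumFin {suc n} signs ≡ + 2
  sumFin-signs n with sumFin {n} alternating | sumFin-alternating n
  ... | _ | inj₁ refl = inj₁ refl
  ... | _ | inj₂ refl = inj₂ refl

  neg-sumFin-signs-nonZeroWithin : ∀ n → NonZeroWithin 2 (- sumFin {suc n} signs)
  neg-sumFin-signs-nonZeroWithin n with sumFin {suc n} signs | sumFin-signs n
  ... | _ | inj₁ refl = nonZeroWithin 2 -1ℤ
  ... | _ | inj₂ refl = nonZeroWithin 2 (- + 2)

  balance : ∀ {n} → (Fin n → ℤ) → Fin (suc n) → ℤ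
  balance v zero    = - sumFin v
  balance v (suc j) = v j

  sumFin-balance : ∀ {n} (v : Fin n → ℤ) → sumFin (balance v) ≡ 0ℤ
  sumFin-balance v = ℤ.+-inverseˡ (sumFin v)

  balance-signs-nonZeroWithin : ∀ n (j : Fin (suc (suc n))) → NonZeroWithin 2 (balance (signs {suc n}) j)
  balance-signs-nonZeroWithin n zero    = neg-sumFin-signs-nonZeroWithin n
  balance-signs-nonZeroWithin n (suc j) =
    nonZeroWithin-weaken {x = signs j} (s≤s z≤n) (sign-nonZeroWithin (signs-sign j))

module Construction (q : ℕ) where

  open FinSum
  open Factorisation using (Null1FactorisationOn)
  open SmallValues
  open import Data.Nat.Base as ℕ using (suc; z≤n; s≤s; _∸_)
  import Data.Nat.Properties as ℕ
  open import Data.Integer.Base using (ℤ; 0ℤ; +_; -_; _+_; _*_)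
  import Data.Integer.Properties as ℤ
  open import Data.Integer.Tactic.RingSolver using (solve-∀)
  open import Data.Fin.Base using (Fin; zero; suc; toℕ; _↑ˡ_; _↑ʳ_; splitAt; opposite)
  open import Data.Fin using (_≟_)
  import Data.Fin.Properties as Fin
  open import Data.Vec.Functional using (_++_)
  open import Data.Vec.Functional.Properties using (lookup-++ˡ; lookup-++ʳ)
  open import Data.Sum.Base as Sum using (_⊎_; inj₁; inj₂)
  open import Data.Sum.Properties using (inj₁-injective; inj₂-injective)
  open import Data.Product.Base using (_×_; _,_; proj₁; proj₂)
  open import Data.Bool.Base using (if_then_else_)
  open import Data.Empty using (⊥-elim)
  open import Function.Base using (_∘_)
  open import Relation.Nullary.Decidable using (does; yes; no)
  open import Relation.Binary.PropositionalEquality hiding ([_])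

  K : ℕ
  K = suc (suc q)

  m : ℕ
  m = suc (K ℕ.+ K)

  open Cyclic (K ℕ.+ K)

  low high : Fin K → Fin m
  low  i = suc (i ↑ˡ K)
  high j = suc (K ↑ʳ j)

  nonzero-elim : (P : Fin m → Set) → (∀ i → P (low i)) → (∀ j → P (high j)) → ∀ t → P (suc t)
  nonzero-elim P P-low P-high t with splitAt K t in eq
  ... | inj₁ i = subst (P ∘ suc) (Fin.splitAt⁻¹-↑ˡ eq) (P-low i)
  ... | inj₂ j = subst (P ∘ suc) (Fin.splitAt⁻¹-↑ʳ eq) (P-high j)

  sumFin-lowHigh : ∀ (g : Fin m → ℤ) → sumFin g ≡ g zero + (sumFin (g ∘ low) + sumFin (g ∘ high))
  sumFin-lowHigh g = cong (λ y → g zero + y) (sumFin-↑ K K (g ∘ suc))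

  toℕ-low : ∀ i → toℕ (low i) ≡ suc (toℕ i)
  toℕ-low i = cong suc (Fin.toℕ-↑ˡ i K)

  toℕ-high : ∀ j → toℕ (high j) ≡ suc (K ℕ.+ toℕ j)
  toℕ-high j = cong suc (Fin.toℕ-↑ʳ K j)

  ⊝-low : ∀ i → ⊝ low i ≡ high (opposite i)
  ⊝-low i = Fin.toℕ-injective (begin
    toℕ (⊝ low i)                         ≡⟨ toℕ-⊝ (low i) (s≤s z≤n) ⟩
    m ∸ toℕ (low i)                       ≡⟨ cong (m ∸_) (toℕ-low i) ⟩
    (K ℕ.+ K) ∸ toℕ i                     ≡⟨ ℕ.+-∸-assoc K (ℕ.<⇒≤ (Fin.toℕ<n i)) ⟩
    K ℕ.+ (K ∸ toℕ i)                     ≡⟨ cong (K ℕ.+_) (ℕ.+-∸-assoc 1 (Fin.toℕ<n i)) ⟩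
    K ℕ.+ suc (K ∸ suc (toℕ i))           ≡⟨ ℕ.+-suc K _ ⟩
    suc (K ℕ.+ (K ∸ suc (toℕ i)))         ≡⟨ cong (λ n → suc (K ℕ.+ n)) (Fin.opposite-prop i) ⟨
    suc (K ℕ.+ toℕ (opposite i))          ≡⟨ toℕ-high (opposite i) ⟨
    toℕ (high (opposite i))               ∎)
    where open ≡-Reasoning

  ⊝-high : ∀ j → ⊝ high j ≡ low (opposite j)
  ⊝-high j = begin
    ⊝ high j                        ≡⟨ cong (λ k → ⊝ high k) (Fin.opposite-involutive j) ⟨
    ⊝ high (opposite (opposite j))  ≡⟨ cong ⊝_ (⊝-low (opposite j)) ⟨
    ⊝ ⊝ low (opposite j)            ≡⟨ ⊝-involutive (low (opposite j)) ⟩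
    low (opposite j)                ∎
    where open ≡-Reasoning

  κ : Fin m
  κ = [ K ]

  high≡low⊕κ : ∀ j → high j ≡ low j ⊕ κ
  high≡low⊕κ j = begin
    high j                          ≡⟨ [toℕ] (high j) ⟨
    [ toℕ (high j) ]                ≡⟨ cong [_] (trans (toℕ-high j) (cong suc (ℕ.+-comm K (toℕ j)))) ⟩
    [ suc (toℕ j) ℕ.+ K ]           ≡⟨ cong (λ n → [ n ℕ.+ K ]) (toℕ-low j) ⟨
    [ toℕ (low j) ℕ.+ K ]           ≡⟨ []-+ (toℕ (low j)) K ⟩
    [ toℕ (low j) ] ⊕ κ             ≡⟨ cong (_⊕ κ) ([toℕ] (low j)) ⟩
    low j ⊕ κ                       ∎
    where open ≡-Reasoning

  -- ⊝ exchanges the halves low and high, so F x = 2 δ i − δ j is odd and at most 3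
  -- in size for x ≠ 0.
  δ : Fin K → ℤ
  δ = signs

  G⁺ : Fin (K ℕ.+ K) → ℤ
  G⁺ = (λ i → + 2 * δ i) ++ (λ j → - δ j)

  G : Fin m → ℤ
  G = balance G⁺

  F : Fin m → ℤ
  F x = G x + G (⊝ x)

  -- σ needs k ≥ 2: for k = 1 its first entry would be an empty sum.
  σ : Fin K → ℤ
  σ = balance (signs {suc q})

  h : Fin m → ℤ
  h = balance signs

  Y : Fin m → Fin m → ℤ
  Y zero    a = F zero
  Y (suc t) a = ((λ i → σ i * - h a) ++ (λ j → σ j * h (a ⊕ κ))) t

  G-low : ∀ i → G (low i) ≡ + 2 * δ i
  G-low = lookup-++ˡ (λ i → + 2 * δ i) (λ j → - δ j)

  G-high : ∀ j → G (high j) ≡ - δ j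
  G-high = lookup-++ʳ (λ i → + 2 * δ i) (λ j → - δ j)

  Y-low : ∀ i a → Y (low i) a ≡ σ i * - h a
  Y-low i a = lookup-++ˡ (λ i → σ i * - h a) (λ j → σ j * h (a ⊕ κ)) i

  Y-high : ∀ j a → Y (high j) a ≡ σ j * h (a ⊕ κ)
  Y-high j a = lookup-++ʳ (λ i → σ i * - h a) (λ j → σ j * h (a ⊕ κ)) j

  G-zero : G zero ≡ - sumFin δ
  G-zero = cong -_ (begin
    sumFin G⁺
      ≡⟨ sumFin-splitAt K K Sum.[ (λ i → + 2 * δ i) , (λ j → - δ j) ] ⟩
    sumFin (λ i → + 2 * δ i) + sumFin (λ j → - δ j)
      ≡⟨ cong₂ _+_ (sumFin-*ˡ (+ 2) δ) (sumFin-neg δ) ⟩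
    + 2 * sumFin δ + - sumFin δ
      ≡⟨ twice-minus-once (sumFin δ) ⟩
    sumFin δ ∎)
    where
    open ≡-Reasoning
    twice-minus-once : ∀ x → + 2 * x + - x ≡ x
    twice-minus-once = solve-∀

  F-even : ∀ x → F (⊝ x) ≡ F x
  F-even x = trans (cong (λ y → G (⊝ x) + G y) (⊝-involutive x)) (ℤ.+-comm (G (⊝ x)) (G x))

  sumFin-F : sumFin F ≡ 0ℤ
  sumFin-F = begin
    sumFin F                            ≡⟨ sumFin-+ G (G ∘ ⊝_) ⟩
    sumFin G + sumFin (λ x → G (⊝ x))   ≡⟨ cong (λ y → sumFin G + y) (sumFin-negate G) ⟩
    sumFin G + sumFin G                 ≡⟨ cong₂ _+_ (sumFin-balance G⁺) (sumFin-balance G⁺) ⟩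
    0ℤ                                  ∎
    where open ≡-Reasoning

  sumFin-h : sumFin h ≡ 0ℤ
  sumFin-h = sumFin-balance (signs {K ℕ.+ K})

  sumFin-σ-* : ∀ c → sumFin (λ i → σ i * c) ≡ 0ℤ
  sumFin-σ-* c = trans (sumFin-*ʳ c σ) (cong (_* c) (sumFin-balance (signs {suc q})))

  F-nonZeroWithin : ∀ x → NonZeroWithin 4 (F x)
  F-nonZeroWithin zero rewrite ⊝-zero | G-zero with sumFin δ | sumFin-signs (suc q)
  ... | _ | inj₁ refl = nonZeroWithin 4 (- + 2)
  ... | _ | inj₂ refl = nonZeroWithin 4 (- + 4)
  F-nonZeroWithin (suc t) = nonzero-elim (NonZeroWithin 4 ∘ F) F-low F-high t
    where
    F-low : ∀ i → NonZeroWithin 4 (F (low i))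
    F-low i rewrite ⊝-low i | G-low i | G-high (opposite i) =
      nonZeroWithin-weaken (s≤s (s≤s (s≤s z≤n)))
        (twice-minus-nonZeroWithin (signs-sign i) (signs-sign (opposite i)))
    F-high : ∀ j → NonZeroWithin 4 (F (high j))
    F-high j rewrite ⊝-high j | G-high j | G-low (opposite j)
                   | ℤ.+-comm (- δ j) (+ 2 * δ (opposite j)) =
      nonZeroWithin-weaken (s≤s (s≤s (s≤s z≤n)))
        (twice-minus-nonZeroWithin (signs-sign (opposite j)) (signs-sign j))

  Y-nonZeroWithin : ∀ d a → NonZeroWithin 4 (Y d a)
  Y-nonZeroWithin zero    a = F-nonZeroWithin zero
  Y-nonZeroWithin (suc t) a = nonzero-elim (λ d → NonZeroWithin 4 (Y d a)) Y-low-within Y-high-within t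
    where
    σ-within : ∀ i → NonZeroWithin 2 (σ i)
    σ-within = balance-signs-nonZeroWithin q
    h-within : ∀ a → NonZeroWithin 2 (h a)
    h-within = balance-signs-nonZeroWithin (suc q ℕ.+ K)
    Y-low-within : ∀ i → NonZeroWithin 4 (Y (low i) a)
    Y-low-within i rewrite Y-low i a = nonZeroWithin-* (σ-within i) (nonZeroWithin-neg (h-within a))
    Y-high-within : ∀ j → NonZeroWithin 4 (Y (high j) a)
    Y-high-within j rewrite Y-high j a = nonZeroWithin-* (σ-within j) (h-within (a ⊕ κ))

  sumFin-Y-row : ∀ a → sumFin (λ d → Y d a) ≡ F zero
  sumFin-Y-row a = begin
    sumFin (λ d → Y d a)
      ≡⟨ sumFin-lowHigh (λ d → Y d a) ⟩
    F zero + (sumFin (λ i → Y (low i) a) + sumFin (λ j → Y (high j) a))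
      ≡⟨ cong (λ y → F zero + y) (cong₂ _+_
           (trans (sumFin-cong (λ i → Y-low i a)) (sumFin-σ-* (- h a)))
           (trans (sumFin-cong (λ j → Y-high j a)) (sumFin-σ-* (h (a ⊕ κ))))) ⟩
    F zero + 0ℤ
      ≡⟨ ℤ.+-identityʳ (F zero) ⟩
    F zero ∎
    where open ≡-Reasoning

  sumFin-Y-column : ∀ b → sumFin (λ d → Y d (b ⊖ d)) ≡ F zero
  sumFin-Y-column b = begin
    sumFin (λ d → Y d (b ⊖ d))
      ≡⟨ sumFin-lowHigh (λ d → Y d (b ⊖ d)) ⟩
    F zero + (sumFin (λ i → Y (low i) (b ⊖ low i)) + sumFin (λ j → Y (high j) (b ⊖ high j)))
      ≡⟨ cong (λ y → F zero + y) (cong₂ _+_ (sumFin-cong (λ i → Y-low i (b ⊖ low i)))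
                                            (sumFin-cong Y-high-column)) ⟩
    F zero + (sumFin (λ i → σ i * - h (b ⊖ low i)) + sumFin (λ i → σ i * h (b ⊖ low i)))
      ≡⟨ cong (λ y → F zero + y) (sumFin-+ (λ i → σ i * - h (b ⊖ low i)) (λ i → σ i * h (b ⊖ low i))) ⟨
    F zero + sumFin (λ i → σ i * - h (b ⊖ low i) + σ i * h (b ⊖ low i))
      ≡⟨ cong (λ y → F zero + y) (trans (sumFin-cong (λ i → cancel (σ i) (h (b ⊖ low i)))) (sumFin-zero K)) ⟩
    F zero + 0ℤ
      ≡⟨ ℤ.+-identityʳ (F zero) ⟩
    F zero ∎
    where
    open ≡-Reasoning
    Y-high-column : ∀ j → Y (high j) (b ⊖ high j) ≡ σ j * h (b ⊖ low j)
    Y-high-column j = trans (Y-high j (b ⊖ high j)) (cong (λ c → σ j * h c)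
      (trans (cong (λ c → (b ⊖ c) ⊕ κ) (high≡low⊕κ j)) (⊖-⊕-shift b (low j) κ)))
    cancel : ∀ x y → x * - y + x * y ≡ 0ℤ
    cancel = solve-∀

  sumFin-Y : ∀ t → sumFin (Y (suc t)) ≡ 0ℤ
  sumFin-Y = nonzero-elim (λ d → sumFin (Y d) ≡ 0ℤ) sum-low sum-high
    where
    open ≡-Reasoning
    sum-low : ∀ i → sumFin (Y (low i)) ≡ 0ℤ
    sum-low i = begin
      sumFin (Y (low i))                ≡⟨ sumFin-cong (Y-low i) ⟩
      sumFin (λ a → σ i * - h a)        ≡⟨ sumFin-*ˡ (σ i) (λ a → - h a) ⟩
      σ i * sumFin (λ a → - h a)        ≡⟨ cong (σ i *_) (trans (sumFin-neg h) (cong -_ sumFin-h)) ⟩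
      σ i * 0ℤ                          ≡⟨ ℤ.*-zeroʳ (σ i) ⟩
      0ℤ                                ∎
    sum-high : ∀ j → sumFin (Y (high j)) ≡ 0ℤ
    sum-high j = begin
      sumFin (Y (high j))               ≡⟨ sumFin-cong (Y-high j) ⟩
      sumFin (λ a → σ j * h (a ⊕ κ))    ≡⟨ sumFin-*ˡ (σ j) (λ a → h (a ⊕ κ)) ⟩
      σ j * sumFin (λ a → h (a ⊕ κ))    ≡⟨ cong (σ j *_) (trans (sumFin-translate κ h) sumFin-h) ⟩
      σ j * 0ℤ                          ≡⟨ ℤ.*-zeroʳ (σ j) ⟩
      0ℤ                                ∎

  Vertex Colour : Set
  Vertex = Fin m ⊎ Fin m
  Colour = Fin m ⊎ Fin (K ℕ.+ K)

  crossColour : Fin m → Fin m → Fin m → Colour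
  crossColour a b zero    = inj₁ (a ⊕ b)
  crossColour a b (suc t) = inj₂ t

  colour : Vertex → Vertex → Colour
  colour (inj₁ a) (inj₁ b) = inj₁ (a ⊕ b)
  colour (inj₂ a) (inj₂ b) = inj₁ (a ⊕ b)
  colour (inj₁ a) (inj₂ b) = crossColour a b (b ⊖ a)
  colour (inj₂ b) (inj₁ a) = crossColour a b (b ⊖ a)

  flow : Vertex → Vertex → ℤ
  flow (inj₁ a) (inj₁ b) = F (b ⊖ a)
  flow (inj₂ a) (inj₂ b) = F (b ⊖ a)
  flow (inj₁ a) (inj₂ b) = Y (b ⊖ a) a
  flow (inj₂ b) (inj₁ a) = Y (b ⊖ a) a

  partner : Colour → Vertex → Vertex
  partner (inj₁ s) (inj₁ a) = if does (a ≟ s ⊖ a) then inj₂ a else inj₁ (s ⊖ a)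
  partner (inj₁ s) (inj₂ a) = if does (a ≟ s ⊖ a) then inj₁ a else inj₂ (s ⊖ a)
  partner (inj₂ t) (inj₁ a) = inj₂ (a ⊕ suc t)
  partner (inj₂ t) (inj₂ b) = inj₁ (b ⊖ suc t)

  ∑ : (Vertex → ℤ) → ℤ
  ∑ g = sumFin (g ∘ inj₁) + sumFin (g ∘ inj₂)

  crossColour-diagonal : ∀ a → crossColour a a (a ⊖ a) ≡ inj₁ (a ⊕ a)
  crossColour-diagonal a rewrite ⊕-inverseʳ a = refl

  crossColour≡inj₁ : ∀ {a b s} → crossColour a b (b ⊖ a) ≡ inj₁ s → b ≡ a × a ⊕ b ≡ s
  crossColour≡inj₁ {a} {b} eq with b ⊖ a in b⊖a≡0
  ... | zero = ⊖≡0⇒≡ b⊖a≡0 , inj₁-injective eq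

  crossColour≡inj₂ : ∀ {a b t} → crossColour a b (b ⊖ a) ≡ inj₂ t → b ⊖ a ≡ suc t
  crossColour≡inj₂ {a} {b} eq with b ⊖ a
  ... | suc _ = cong suc (inj₂-injective eq)

  a⊕a≡s : ∀ {a s} → a ≡ s ⊖ a → a ⊕ a ≡ s
  a⊕a≡s {a} {s} a≡s⊖a = trans (cong (a ⊕_) a≡s⊖a) (a⊕[b⊖a]≡b a s)

  Matched : Colour → Vertex → Vertex → Set
  Matched i x y = x ≢ y × colour x y ≡ i × (∀ z → x ≢ z → colour x z ≡ i → z ≡ y)

  sumColour-matched : ∀ s x → Matched (inj₁ s) x (partner (inj₁ s) x)
  sumColour-matched s (inj₁ a) with a ≟ s ⊖ a
  ... | yes a≡s⊖a = (λ ()) , trans (crossColour-diagonal a) (cong inj₁ (a⊕a≡s a≡s⊖a)) , unique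
    where
    unique : ∀ z → inj₁ a ≢ z → colour (inj₁ a) z ≡ inj₁ s → z ≡ inj₂ a
    unique (inj₁ b) a≢b eq = ⊥-elim (a≢b (cong inj₁ (trans a≡s⊖a (sym (⊕≡⇒≡⊖ (inj₁-injective eq))))))
    unique (inj₂ b) _   eq = cong inj₂ (proj₁ (crossColour≡inj₁ eq))
  ... | no a≢s⊖a = a≢s⊖a ∘ inj₁-injective , cong inj₁ (a⊕[b⊖a]≡b a s) , unique
    where
    unique : ∀ z → inj₁ a ≢ z → colour (inj₁ a) z ≡ inj₁ s → z ≡ inj₁ (s ⊖ a)
    unique (inj₁ b) _ eq = cong inj₁ (⊕≡⇒≡⊖ (inj₁-injective eq))
    unique (inj₂ b) _ eq with refl , a⊕a≡s ← crossColour≡inj₁ eq = ⊥-elim (a≢s⊖a (⊕≡⇒≡⊖ a⊕a≡s))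
  sumColour-matched s (inj₂ a) with a ≟ s ⊖ a
  ... | yes a≡s⊖a = (λ ()) , trans (crossColour-diagonal a) (cong inj₁ (a⊕a≡s a≡s⊖a)) , unique
    where
    unique : ∀ z → inj₂ a ≢ z → colour (inj₂ a) z ≡ inj₁ s → z ≡ inj₁ a
    unique (inj₂ b) a≢b eq = ⊥-elim (a≢b (cong inj₂ (trans a≡s⊖a (sym (⊕≡⇒≡⊖ (inj₁-injective eq))))))
    unique (inj₁ b) _   eq = cong inj₁ (sym (proj₁ (crossColour≡inj₁ eq)))
  ... | no a≢s⊖a = a≢s⊖a ∘ inj₂-injective , cong inj₁ (a⊕[b⊖a]≡b a s) , unique
    where
    unique : ∀ z → inj₂ a ≢ z → colour (inj₂ a) z ≡ inj₁ s → z ≡ inj₂ (s ⊖ a)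
    unique (inj₂ b) _ eq = cong inj₂ (⊕≡⇒≡⊖ (inj₁-injective eq))
    unique (inj₁ b) _ eq with refl , a⊕a≡s ← crossColour≡inj₁ eq = ⊥-elim (a≢s⊖a (⊕≡⇒≡⊖ a⊕a≡s))

  differenceColour-matched : ∀ t x → Matched (inj₂ t) x (partner (inj₂ t) x)
  differenceColour-matched t (inj₁ a) = (λ ()) , colour-partner , unique
    where
    colour-partner : crossColour a (a ⊕ suc t) ((a ⊕ suc t) ⊖ a) ≡ inj₂ t
    colour-partner rewrite ⊕-⊖-cancelˡ a (suc t) = refl
    unique : ∀ z → inj₁ a ≢ z → colour (inj₁ a) z ≡ inj₂ t → z ≡ inj₂ (a ⊕ suc t)
    unique (inj₂ b) _ eq = cong inj₂ (⊖≡⇒≡⊕ (crossColour≡inj₂ eq))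
  differenceColour-matched t (inj₂ b) = (λ ()) , colour-partner , unique
    where
    colour-partner : crossColour (b ⊖ suc t) b (b ⊖ (b ⊖ suc t)) ≡ inj₂ t
    colour-partner rewrite ⊖-⊖-cancel b (suc t) = refl
    unique : ∀ z → inj₂ b ≢ z → colour (inj₂ b) z ≡ inj₂ t → z ≡ inj₁ (b ⊖ suc t)
    unique (inj₁ a) _ eq = cong inj₁ (⊖≡⇒≡⊖ (crossColour≡inj₂ eq))

  matched : ∀ i x → Matched i x (partner i x)
  matched (inj₁ s) = sumColour-matched s
  matched (inj₂ t) = differenceColour-matched t

  flow-sym : ∀ x y → flow x y ≡ flow y x
  flow-sym (inj₁ a) (inj₁ b) = trans (sym (F-even (b ⊖ a))) (cong F (sym (⊖-anticomm a b)))
  flow-sym (inj₂ a) (inj₂ b) = trans (sym (F-even (b ⊖ a))) (cong F (sym (⊖-anticomm a b)))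
  flow-sym (inj₁ a) (inj₂ b) = refl
  flow-sym (inj₂ b) (inj₁ a) = refl

  colour-sym : ∀ x y → colour x y ≡ colour y x
  colour-sym (inj₁ a) (inj₁ b) = cong inj₁ (⊕-comm a b)
  colour-sym (inj₂ a) (inj₂ b) = cong inj₁ (⊕-comm a b)
  colour-sym (inj₁ a) (inj₂ b) = refl
  colour-sym (inj₂ b) (inj₁ a) = refl

  flow-nonZeroWithin : ∀ x y → NonZeroWithin 4 (flow x y)
  flow-nonZeroWithin (inj₁ a) (inj₁ b) = F-nonZeroWithin (b ⊖ a)
  flow-nonZeroWithin (inj₂ a) (inj₂ b) = F-nonZeroWithin (b ⊖ a)
  flow-nonZeroWithin (inj₁ a) (inj₂ b) = Y-nonZeroWithin (b ⊖ a) a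
  flow-nonZeroWithin (inj₂ b) (inj₁ a) = Y-nonZeroWithin (b ⊖ a) a

  ∑-flow : ∀ x → ∑ (flow x) ≡ flow x x
  ∑-flow (inj₁ a) = begin
    sumFin (λ b → F (b ⊖ a)) + sumFin (λ b → Y (b ⊖ a) a)
      ≡⟨ cong₂ _+_ (trans (sumFin-translate (⊝ a) F) sumFin-F)
                   (trans (sumFin-translate (⊝ a) (λ d → Y d a)) (sumFin-Y-row a)) ⟩
    0ℤ + F zero                  ≡⟨ ℤ.+-identityˡ (F zero) ⟩
    F zero                       ≡⟨ cong F (⊕-inverseʳ a) ⟨
    F (a ⊖ a)                    ∎
    where open ≡-Reasoning
  ∑-flow (inj₂ b) = begin
    sumFin (λ a → Y (b ⊖ a) a) + sumFin (λ c → F (c ⊖ b))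
      ≡⟨ cong₂ _+_ column (trans (sumFin-translate (⊝ b) F) sumFin-F) ⟩
    F zero + 0ℤ                  ≡⟨ ℤ.+-identityʳ (F zero) ⟩
    F zero                       ≡⟨ cong F (⊕-inverseʳ b) ⟨
    F (b ⊖ b)                    ∎
    where
    open ≡-Reasoning
    column : sumFin (λ a → Y (b ⊖ a) a) ≡ F zero
    column = begin
      sumFin (λ a → Y (b ⊖ a) a)              ≡⟨ sumFin-reflect b (λ a → Y (b ⊖ a) a) ⟨
      sumFin (λ d → Y (b ⊖ (b ⊖ d)) (b ⊖ d))  ≡⟨ sumFin-cong (λ d → cong (λ c → Y c (b ⊖ d)) (⊖-⊖-cancel b d)) ⟩
      sumFin (λ d → Y d (b ⊖ d))              ≡⟨ sumFin-Y-column b ⟩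
      F zero                                  ∎

  Y-diagonal : ∀ a → Y (a ⊖ a) a ≡ F (a ⊖ a)
  Y-diagonal a rewrite ⊕-inverseʳ a = refl

  flow-partner₁ : ∀ s a → flow (inj₁ a) (partner (inj₁ s) (inj₁ a)) ≡ F ((s ⊖ a) ⊖ a)
  flow-partner₁ s a with a ≟ s ⊖ a
  ... | yes a≡s⊖a = trans (Y-diagonal a) (cong (λ c → F (c ⊖ a)) a≡s⊖a)
  ... | no _      = refl

  flow-partner₂ : ∀ s a → flow (inj₂ a) (partner (inj₁ s) (inj₂ a)) ≡ F ((s ⊖ a) ⊖ a)
  flow-partner₂ s a with a ≟ s ⊖ a
  ... | yes a≡s⊖a = trans (Y-diagonal a) (cong (λ c → F (c ⊖ a)) a≡s⊖a)
  ... | no _      = refl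

  sumFin-F-⊖-twice : ∀ s → sumFin (λ a → F ((s ⊖ a) ⊖ a)) ≡ 0ℤ
  sumFin-F-⊖-twice s = begin
    sumFin (λ a → F ((s ⊖ a) ⊖ a))   ≡⟨ sumFin-cong (λ a → cong F (⊖-⊖ s a a)) ⟩
    sumFin (λ a → F (s ⊖ (a ⊕ a)))   ≡⟨ sumFin-double {K} refl (λ y → F (s ⊖ y)) ⟩
    sumFin (λ y → F (s ⊖ y))         ≡⟨ sumFin-reflect s F ⟩
    sumFin F                         ≡⟨ sumFin-F ⟩
    0ℤ                               ∎
    where open ≡-Reasoning

  ∑-flow-partner : ∀ i → ∑ (λ x → flow x (partner i x)) ≡ 0ℤ
  ∑-flow-partner (inj₁ s) = begin
    ∑ (λ x → flow x (partner (inj₁ s) x))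
      ≡⟨ cong₂ _+_ (sumFin-cong (flow-partner₁ s)) (sumFin-cong (flow-partner₂ s)) ⟩
    sumFin (λ a → F ((s ⊖ a) ⊖ a)) + sumFin (λ a → F ((s ⊖ a) ⊖ a))
      ≡⟨ cong₂ _+_ (sumFin-F-⊖-twice s) (sumFin-F-⊖-twice s) ⟩
    0ℤ ∎
    where open ≡-Reasoning
  ∑-flow-partner (inj₂ t) = begin
    sumFin (λ a → Y ((a ⊕ d) ⊖ a) a) + sumFin (λ b → Y (b ⊖ (b ⊖ d)) (b ⊖ d))
      ≡⟨ cong₂ _+_ (sumFin-cong (λ a → cong (λ c → Y c a) (⊕-⊖-cancelˡ a d)))
                   (sumFin-cong (λ b → cong (λ c → Y c (b ⊖ d)) (⊖-⊖-cancel b d))) ⟩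
    sumFin (Y d) + sumFin (λ b → Y d (b ⊖ d))
      ≡⟨ cong (λ y → sumFin (Y d) + y) (sumFin-translate (⊝ d) (Y d)) ⟩
    sumFin (Y d) + sumFin (Y d)
      ≡⟨ cong₂ _+_ (sumFin-Y t) (sumFin-Y t) ⟩
    0ℤ ∎
    where
    open ≡-Reasoning
    d = suc t

  null1Factorisation : Null1FactorisationOn 5 Vertex Colour ∑
  null1Factorisation = record
    { flow           = flow
    ; colour         = colour
    ; partner        = partner
    ; flow-sym       = flow-sym
    ; colour-sym     = colour-sym
    ; flow-nonZero   = λ x y _ → nonZeroWithin⇒≢0 (flow-nonZeroWithin x y)
    ; flow-bounded   = λ x y _ → NonZeroWithin.∣x∣≤b (flow-nonZeroWithin x y)
    ; partner-≢      = λ i x → proj₁ (matched i x)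
    ; colour-partner = λ i x → proj₁ (proj₂ (matched i x))
    ; partner-unique = λ i x → proj₂ (proj₂ (matched i x))
    ; ∑-flow         = ∑-flow
    ; ∑-flow-partner = ∑-flow-partner
    }

open import Data.Nat.Base using (_<_; _+_; _*_; zero; suc; s≤s)
open import Data.Nat.Tactic.RingSolver using (solve-∀)
open import Data.Fin.Properties using (+↔⊎)
open import Relation.Binary.PropositionalEquality using (_≡_; subst)
open Factorisation using (relabel; hasNull1Factorisation)

vertexCount : ∀ K → suc (K + K) + suc (K + K) ≡ 4 * K + 2
vertexCount = solve-∀

mainTheorem18 : (k : ℕ) → 1 < k → HasNull1Factorisation 5 (4 * k + 2)
mainTheorem18 (suc zero) (s≤s ())
mainTheorem18 (suc (suc q)) _ = subst (HasNull1Factorisation 5) (vertexCount K)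
  (hasNull1Factorisation (relabel +↔⊎ +↔⊎ (FinSum.sumFin-splitAt m m) null1Factorisation))
  where open Construction q
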